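{- Let $n\geq 4$ and let $G\in\mathcal{GAQ}_n$ be a generalized augmented cube. (i) If $(a,b)$ is an edge of $G$, $A$ is the set of neighbors of $a$ and $B$ is the set of neighbors of $b$, then $|(A\setminus\{b\})\setminus(B\setminus\{a\})|\geq 2$. (ii) If $a$ and $b$ are nonadjacent vertices of $G$, $A$ is the set of neighbors of $a$ and $B$ is the set of neighbors of $b$, then $|A\setminus B|\geq 2$.
   Context: The augmented cube $AQ_n$: vertices are $n$-bit binary strings; $AQ_1\cong K_2$; for $n\geq2$, take copies $AQ^0_{n-1}$ and $AQ^1_{n-1}$ of $AQ_{n-1}$ (vertices prefixed by $0$ and $1$ respectively), and join $0u_1\cdots u_{n-1}$ to $1v_1\cdots v_{n-1}$ iff $u_i=v_i$ for all $i$ (cross edge) or $u_i\neq v_i$ for all $i$ (complement edge). $\mathcal{GAQ}_4=\{AQ_4\}$; for $n\geq5$, $\mathcal{GAQ}_n$ consists of all graphs $(V_1\cup V_2,E_1\cup E_2\cup M_1\cup M_2)$ with $(V_1,E_1),(V_2,E_2)\in\mathcal{GAQ}_{n-1}$ on disjoint vertex sets and $M_1,M_2$ edge-disjoint perfect matchings between $V_1$ and $V_2$. -}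

module Defs where

open import Data.Nat using (ℕ; zero; suc)
open import Data.Bool using (Bool)
open import Data.Vec using (Vec; []; _∷_; lookup)
open import Data.Fin using (Fin)
open import Data.Sum using (_⊎_; inj₁; inj₂)
open import Data.Product using (_×_; Σ)
open import Data.Empty using (⊥)
open import Relation.Nullary using (¬_)
open import Relation.Binary.PropositionalEquality using (_≡_; _≢_)
open import Function.Bundles using (_↔_; Inverse)

record Graph : Set₁ where
  field
    V   : Set
    Adj : V → V → Set

-- AQ_0 has no edges, so the suc case at n = 1 yields exactly K_2.
-- For x ∷ u and y ∷ v: same first bit -> edge of the sub-copy AQ_{n-1};
-- different first bit -> cross edge (u = v) or complement edge (u_i ≠ v_i ∀ i).
AQAdj : (n : ℕ) → Vec Bool n → Vec Bool n → Set
AQAdj zero    _        _        = ⊥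
AQAdj (suc n) (x ∷ u) (y ∷ v) =
  (x ≡ y × AQAdj n u v) ⊎
  (x ≢ y × (u ≡ v ⊎ (∀ (i : Fin n) → lookup u i ≢ lookup v i)))

AQ : ℕ → Graph
AQ n = record { V = Vec Bool n ; Adj = AQAdj n }

-- Join of two graphs by two perfect matchings between their vertex sets.
-- A perfect matching between V₁ and V₂ is given by a bijection V₁ ↔ V₂.
joinAdj : (G₁ G₂ : Graph) → (Graph.V G₁ ↔ Graph.V G₂) → (Graph.V G₁ ↔ Graph.V G₂) →
          (Graph.V G₁ ⊎ Graph.V G₂) → (Graph.V G₁ ⊎ Graph.V G₂) → Set
joinAdj G₁ G₂ f g (inj₁ x) (inj₁ y) = Graph.Adj G₁ x y
joinAdj G₁ G₂ f g (inj₂ x) (inj₂ y) = Graph.Adj G₂ x y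
joinAdj G₁ G₂ f g (inj₁ x) (inj₂ y) = (Inverse.to f x ≡ y) ⊎ (Inverse.to g x ≡ y)
joinAdj G₁ G₂ f g (inj₂ y) (inj₁ x) = (Inverse.to f x ≡ y) ⊎ (Inverse.to g x ≡ y)

join : (G₁ G₂ : Graph) → (Graph.V G₁ ↔ Graph.V G₂) → (Graph.V G₁ ↔ Graph.V G₂) → Graph
join G₁ G₂ f g = record { V = Graph.V G₁ ⊎ Graph.V G₂ ; Adj = joinAdj G₁ G₂ f g }

data GAQ : ℕ → Graph → Set₁ where
  base : GAQ 4 (AQ 4)
  step : ∀ {n G₁ G₂} → GAQ n G₁ → GAQ n G₂ →
         (f g : Graph.V G₁ ↔ Graph.V G₂) →
         (∀ x → Inverse.to f x ≢ Inverse.to g x) →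
         GAQ (suc n) (join G₁ G₂ f g)

AtLeastTwo : {A : Set} → (A → Set) → Set
AtLeastTwo {A} S = Σ A λ x → Σ A λ y → x ≢ y × S x × S y

-- Both properties hold in AQ₄ by exhaustive check, and they survive the join
-- G₁ ⊕ G₂ together with the fact that every vertex has at least four
-- neighbours. For a and b in the same copy the witnesses of that copy still
-- work, since the copy is an induced subgraph. For a ∈ G₁ and b ∈ G₂, the
-- vertex b has only two neighbours in G₁ (its partners under the two
-- matchings), so two of the at least four neighbours of a in G₁ avoid them.
module Submission where

open import Defs
open import Data.Bool using (Bool; true; false)
open import Data.Bool.Properties using () renaming (_≟_ to _≟ᵇ_)
open import Data.Fin.Properties using (all?)
open import Data.Nat using (ℕ; zero; suc; _≤_)
open import Data.Product using (_×_; _,_; ∃; proj₁)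
open import Data.Sum using (_⊎_; inj₁; inj₂; [_,_]; fromInj₁; fromInj₂)
open import Data.Sum.Properties using (inj₁-injective; inj₂-injective)
open import Data.Vec using (Vec; []; _∷_; lookup)
open import Data.Vec.Properties using (≡-dec)
open import Function using (_∘_; id; const)
open import Function.Bundles using (_↔_; Inverse)
open import Function.Definitions using (Injective)
open import Relation.Binary.PropositionalEquality using (_≡_; _≢_; refl; sym; cong)
open import Relation.Nullary using (¬_; Dec; no; ¬?)
open import Relation.Nullary.Decidable using (map′; from-yes; _×-dec_; _⊎-dec_; _→-dec_)
open import Relation.Unary using (Decidable)

open Graph

atLeastTwo-map : {A B : Set} {P : A → Set} {Q : B → Set} (h : A → B) → Injective _≡_ _≡_ h →
                 (∀ {x} → P x → Q (h x)) → AtLeastTwo P → AtLeastTwo Q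
atLeastTwo-map h h-inj P⇒Q (x , y , x≢y , px , py) = h x , h y , x≢y ∘ h-inj , P⇒Q px , P⇒Q py

atLeastTwo-mono : {A : Set} {P Q : A → Set} → (∀ {x} → P x → Q x) → AtLeastTwo P → AtLeastTwo Q
atLeastTwo-mono = atLeastTwo-map id id

module _ (G : Graph) where

  EdgePrivateNeighbour : V G → V G → V G → Set
  EdgePrivateNeighbour a b x = (Adj G a x × x ≢ b) × ¬ (Adj G b x × x ≢ a)

  PrivateNeighbour : V G → V G → V G → Set
  PrivateNeighbour a b x = Adj G a x × ¬ Adj G b x

  ExclusiveNeighbour : V G → V G → V G → Set
  ExclusiveNeighbour a b x = (Adj G a x × x ≢ b) × ¬ Adj G b x

  exclusive⇒edgePrivate : ∀ {a b} → AtLeastTwo (ExclusiveNeighbour a b) → AtLeastTwo (EdgePrivateNeighbour a b)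
  exclusive⇒edgePrivate = atLeastTwo-mono λ (ax , ¬bx) → ax , ¬bx ∘ proj₁

  exclusive⇒private : ∀ {a b} → AtLeastTwo (ExclusiveNeighbour a b) → AtLeastTwo (PrivateNeighbour a b)
  exclusive⇒private = atLeastTwo-mono λ ((ax , _) , ¬bx) → ax , ¬bx

  -- Minimum degree at least four, in the form consumed by the join step.
  DegreeAtLeast4 : Set
  DegreeAtLeast4 = ∀ a p q → AtLeastTwo (λ x → Adj G a x × x ≢ p × x ≢ q)

  TwoEdgePrivateNeighbours : Set
  TwoEdgePrivateNeighbours = ∀ a b → Adj G a b → AtLeastTwo (EdgePrivateNeighbour a b)

  TwoPrivateNeighbours : Set
  TwoPrivateNeighbours = ∀ a b → a ≢ b → ¬ Adj G a b → AtLeastTwo (PrivateNeighbour a b)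

record Separating (G : Graph) : Set where
  field
    degree≥4        : DegreeAtLeast4 G
    edge-private    : TwoEdgePrivateNeighbours G
    nonEdge-private : TwoPrivateNeighbours G

record InducedEmbedding (H K : Graph) : Set where
  field
    embed         : V H → V K
    injective     : Injective _≡_ _≡_ embed
    preserves-adj : ∀ {x y} → Adj H x y → Adj K (embed x) (embed y)
    reflects-adj  : ∀ {x y} → Adj K (embed x) (embed y) → Adj H x y

module _ {H K : Graph} (ι : InducedEmbedding H K) where
  open InducedEmbedding ι

  edgePrivate-embed : ∀ {a b} → AtLeastTwo (EdgePrivateNeighbour H a b) →
                      AtLeastTwo (EdgePrivateNeighbour K (embed a) (embed b))
  edgePrivate-embed = atLeastTwo-map embed injective λ ((ax , x≢b) , ¬bx) →
    (preserves-adj ax , x≢b ∘ injective) , λ (bx , x≢a) → ¬bx (reflects-adj bx , x≢a ∘ cong embed)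

  private-embed : ∀ {a b} → AtLeastTwo (PrivateNeighbour H a b) →
                  AtLeastTwo (PrivateNeighbour K (embed a) (embed b))
  private-embed = atLeastTwo-map embed injective λ (ax , ¬bx) → preserves-adj ax , ¬bx ∘ reflects-adj

inj₁-preimage : {A B : Set} {x : A} (d : A) (p : A ⊎ B) → inj₁ x ≡ p → x ≡ fromInj₁ (const d) p
inj₁-preimage _ (inj₁ _) refl = refl

inj₂-preimage : {A B : Set} {x : B} (d : B) (p : A ⊎ B) → inj₂ x ≡ p → x ≡ fromInj₂ (const d) p
inj₂-preimage _ (inj₂ _) refl = refl

module Join (G₁ G₂ : Graph) (f g : V G₁ ↔ V G₂) where
  open Inverse

  private
    J : Graph
    J = join G₁ G₂ f g

  left : InducedEmbedding G₁ J
  left = record { embed = inj₁ ; injective = inj₁-injective ; preserves-adj = id ; reflects-adj = id }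

  right : InducedEmbedding G₂ J
  right = record { embed = inj₂ ; injective = inj₂-injective ; preserves-adj = id ; reflects-adj = id }

  neighbour-across₁ : ∀ {b x} → Adj J (inj₂ b) (inj₁ x) → x ≡ from f b ⊎ x ≡ from g b
  neighbour-across₁ (inj₁ fx≡b) = inj₁ (sym (inverseʳ f (sym fx≡b)))
  neighbour-across₁ (inj₂ gx≡b) = inj₂ (sym (inverseʳ g (sym gx≡b)))

  neighbour-across₂ : ∀ {b x} → Adj J (inj₁ b) (inj₂ x) → x ≡ to f b ⊎ x ≡ to g b
  neighbour-across₂ (inj₁ fb≡x) = inj₁ (sym fb≡x)
  neighbour-across₂ (inj₂ gb≡x) = inj₂ (sym gb≡x)

  exclusive-across₁ : DegreeAtLeast4 G₁ → ∀ a b → AtLeastTwo (ExclusiveNeighbour J (inj₁ a) (inj₂ b))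
  exclusive-across₁ deg a b = atLeastTwo-map inj₁ inj₁-injective
    (λ (ax , x≢fb , x≢gb) → (ax , λ ()) , [ x≢fb , x≢gb ] ∘ neighbour-across₁)
    (deg a (from f b) (from g b))

  exclusive-across₂ : DegreeAtLeast4 G₂ → ∀ a b → AtLeastTwo (ExclusiveNeighbour J (inj₂ a) (inj₁ b))
  exclusive-across₂ deg a b = atLeastTwo-map inj₂ inj₂-injective
    (λ (ax , x≢fb , x≢gb) → (ax , λ ()) , [ x≢fb , x≢gb ] ∘ neighbour-across₂)
    (deg a (to f b) (to g b))

  degree≥4 : DegreeAtLeast4 G₁ → DegreeAtLeast4 G₂ → DegreeAtLeast4 J
  degree≥4 deg₁ _ (inj₁ a) p q = atLeastTwo-map inj₁ inj₁-injective
    (λ (ax , x≢p , x≢q) → ax , x≢p ∘ inj₁-preimage a p , x≢q ∘ inj₁-preimage a q)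
    (deg₁ a (fromInj₁ (const a) p) (fromInj₁ (const a) q))
  degree≥4 _ deg₂ (inj₂ a) p q = atLeastTwo-map inj₂ inj₂-injective
    (λ (ax , x≢p , x≢q) → ax , x≢p ∘ inj₂-preimage a p , x≢q ∘ inj₂-preimage a q)
    (deg₂ a (fromInj₂ (const a) p) (fromInj₂ (const a) q))

  separating : Separating G₁ → Separating G₂ → Separating J
  separating S₁ S₂ = record
    { degree≥4        = degree≥4 S₁.degree≥4 S₂.degree≥4
    ; edge-private    = edge-private
    ; nonEdge-private = nonEdge-private
    }
    where
    module S₁ = Separating S₁
    module S₂ = Separating S₂

    edge-private : TwoEdgePrivateNeighbours J
    edge-private (inj₁ a) (inj₁ b) ab = edgePrivate-embed left (S₁.edge-private a b ab)
    edge-private (inj₂ a) (inj₂ b) ab = edgePrivate-embed right (S₂.edge-private a b ab)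
    edge-private (inj₁ a) (inj₂ b) _  = exclusive⇒edgePrivate J (exclusive-across₁ S₁.degree≥4 a b)
    edge-private (inj₂ a) (inj₁ b) _  = exclusive⇒edgePrivate J (exclusive-across₂ S₂.degree≥4 a b)

    nonEdge-private : TwoPrivateNeighbours J
    nonEdge-private (inj₁ a) (inj₁ b) a≢b ¬ab = private-embed left (S₁.nonEdge-private a b (a≢b ∘ cong inj₁) ¬ab)
    nonEdge-private (inj₂ a) (inj₂ b) a≢b ¬ab = private-embed right (S₂.nonEdge-private a b (a≢b ∘ cong inj₂) ¬ab)
    nonEdge-private (inj₁ a) (inj₂ b) _ _     = exclusive⇒private J {inj₁ a} (exclusive-across₁ S₁.degree≥4 a b)
    nonEdge-private (inj₂ a) (inj₁ b) _ _     = exclusive⇒private J {inj₂ a} (exclusive-across₂ S₂.degree≥4 a b)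

_≟_ : ∀ {n} → (u v : Vec Bool n) → Dec (u ≡ v)
_≟_ = ≡-dec _≟ᵇ_

∀-bits? : ∀ {n} {P : Vec Bool n → Set} → Decidable P → Dec (∀ v → P v)
∀-bits? {zero}  P? = map′ (λ { p [] → p }) (λ ∀p → ∀p []) (P? [])
∀-bits? {suc n} P? = map′ (λ { (p₀ , p₁) (false ∷ v) → p₀ v ; (p₀ , p₁) (true ∷ v) → p₁ v })
                          (λ ∀p → (λ v → ∀p (false ∷ v)) , (λ v → ∀p (true ∷ v)))
                          (∀-bits? (P? ∘ (false ∷_)) ×-dec ∀-bits? (P? ∘ (true ∷_)))

∃-bits? : ∀ {n} {P : Vec Bool n → Set} → Decidable P → Dec (∃ P)
∃-bits? {zero}  P? = map′ ([] ,_) (λ { ([] , p) → p }) (P? [])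
∃-bits? {suc n} P? = map′ (λ { (inj₁ (v , p)) → false ∷ v , p ; (inj₂ (v , p)) → true ∷ v , p })
                          (λ { (false ∷ v , p) → inj₁ (v , p) ; (true ∷ v , p) → inj₂ (v , p) })
                          (∃-bits? (P? ∘ (false ∷_)) ⊎-dec ∃-bits? (P? ∘ (true ∷_)))

-- Deciding P x before searching for y keeps the exhaustive checks below fast.
atLeastTwo? : ∀ {n} {P : Vec Bool n → Set} → Decidable P → Dec (AtLeastTwo P)
atLeastTwo? {P = P} P? =
  map′ (λ (x , px , y , x≢y , py) → x , y , x≢y , px , py)
       (λ (x , y , x≢y , px , py) → x , px , y , x≢y , py)
       (∃-bits? {P = λ x → P x × ∃ λ y → x ≢ y × P y} λ x → P? x ×-dec ∃-bits? λ y → ¬? (x ≟ y) ×-dec P? y)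

AQAdj? : ∀ n (u v : Vec Bool n) → Dec (AQAdj n u v)
AQAdj? zero    _       _       = no λ ()
AQAdj? (suc n) (x ∷ u) (y ∷ v) =
  (x ≟ᵇ y ×-dec AQAdj? n u v) ⊎-dec (¬? (x ≟ᵇ y) ×-dec (u ≟ v ⊎-dec all? λ i → ¬? (lookup u i ≟ᵇ lookup v i)))

AQ₄-separating : Separating (AQ 4)
AQ₄-separating = record
  { degree≥4 = from-yes (∀-bits? λ a → ∀-bits? λ p → ∀-bits? λ q →
      atLeastTwo? λ x → AQAdj? 4 a x ×-dec ¬? (x ≟ p) ×-dec ¬? (x ≟ q))
  ; edge-private = from-yes (∀-bits? λ a → ∀-bits? λ b → AQAdj? 4 a b →-dec
      atLeastTwo? λ x → (AQAdj? 4 a x ×-dec ¬? (x ≟ b)) ×-dec ¬? (AQAdj? 4 b x ×-dec ¬? (x ≟ a)))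
  ; nonEdge-private = from-yes (∀-bits? λ a → ∀-bits? λ b → ¬? (a ≟ b) →-dec ¬? (AQAdj? 4 a b) →-dec
      atLeastTwo? λ x → AQAdj? 4 a x ×-dec ¬? (AQAdj? 4 b x))
  }

GAQ-separating : ∀ {n G} → GAQ n G → Separating G
GAQ-separating base                           = AQ₄-separating
GAQ-separating (step {G₁ = G₁} {G₂} p q f g _) = Join.separating G₁ G₂ f g (GAQ-separating p) (GAQ-separating q)

lemma3p3 : (n : ℕ) → 4 ≤ n → (G : Graph) → GAQ n G →
    ((a b : Graph.V G) → Graph.Adj G a b →
      AtLeastTwo (λ x → (Graph.Adj G a x × x ≢ b) × ¬ (Graph.Adj G b x × x ≢ a)))
    ×
    ((a b : Graph.V G) → a ≢ b → ¬ Graph.Adj G a b →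
      AtLeastTwo (λ x → Graph.Adj G a x × ¬ Graph.Adj G b x))
lemma3p3 _ _ _ gaq = edge-private , nonEdge-private
  where open Separating (GAQ-separating gaq)
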